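{- For every tree $T$ with at least three vertices, $b_{dR}(T)\leq 2$.
   Context: For a graph $G=(V,E)$, a double Roman dominating function (DRDF) is a function $f:V\to\{0,1,2,3\}$ such that every vertex $v$ with $f(v)=0$ has at least two neighbors $u$ with $f(u)=2$ or at least one neighbor $w$ with $f(w)=3$, and every vertex $v$ with $f(v)=1$ has at least one neighbor $w$ with $f(w)\geq 2$. The weight of $f$ is $\sum_{u\in V}f(u)$, and $\gamma_{dR}(G)$ is the minimum weight of a DRDF on $G$. The double Roman bondage number $b_{dR}(G)$ is the minimum cardinality of an edge set $B\subseteq E(G)$ such that $\gamma_{dR}(G-B)>\gamma_{dR}(G)$, where $G-B$ is the spanning subgraph obtained by deleting the edges of $B$. -}

module Defs where

open import Data.Nat using (ℕ; zero; suc; _≤_; _<_)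
open import Data.Fin using (Fin; toℕ)
open import Data.Fin.Properties using (_≟_)
open import Data.Bool using (Bool; true; false; _∧_; not; _∨_)
open import Data.List using (List; []; _∷_; length; map; allFin; any; head; last)
open import Data.List.Relation.Unary.Unique.Propositional using (Unique)
open import Data.Nat.ListAction using (sum)
open import Data.Product using (Σ; ∃; ∃-syntax; _×_; _,_)
open import Data.Sum using (_⊎_)
open import Data.Maybe using (Maybe; just)
open import Relation.Nullary using (¬_)
open import Relation.Nullary.Decidable using (⌊_⌋)
open import Relation.Binary.PropositionalEquality using (_≡_; _≢_; refl; cong₂)
open import Data.Bool.Properties using (∨-comm)

record Graph (n : ℕ) : Set where
  field
    adj   : Fin n → Fin n → Bool
    sym   : ∀ u v → adj u v ≡ adj v u
    irefl : ∀ v → adj v v ≡ false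
open Graph public

Adj : ∀ {n} → Graph n → Fin n → Fin n → Set
Adj G u v = adj G u v ≡ true

data Walk {n : ℕ} (G : Graph n) : Fin n → Fin n → Set where
  here : ∀ {v} → Walk G v v
  step : ∀ {u w v} → Adj G u w → Walk G w v → Walk G u v

Connected : ∀ {n} → Graph n → Set
Connected G = ∀ u v → Walk G u v

data Chain {n : ℕ} (G : Graph n) : List (Fin n) → Set where
  [] : Chain G []
  [-] : ∀ {v} → Chain G (v ∷ [])
  _∷_ : ∀ {u w vs} → Adj G u w → Chain G (w ∷ vs) → Chain G (u ∷ w ∷ vs)

Cycle : ∀ {n} → Graph n → List (Fin n) → Set
Cycle G vs =
  (3 ≤ length vs) × Unique vs × Chain G vs ×
  (∃[ a ] ∃[ b ] (head vs ≡ just a × last vs ≡ just b × Adj G b a))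

Acyclic : ∀ {n} → Graph n → Set
Acyclic G = ∀ vs → ¬ Cycle G vs

IsTree : ∀ {n} → Graph n → Set
IsTree G = Connected G × Acyclic G

-- Edges and edge deletion.  An edge is an (ordered) pair of adjacent vertices;
-- deleting it removes both orientations.
Edge : ∀ {n} → Graph n → Set
Edge {n} G = Σ (Fin n × Fin n) λ { (u , v) → Adj G u v }

match : ∀ {n} → Fin n → Fin n → Fin n × Fin n → Bool
match u v (a , b) = ⌊ u ≟ a ⌋ ∧ ⌊ v ≟ b ⌋

hitsList : ∀ {n} (G : Graph n) → Fin n → Fin n → List (Edge G) → Bool
hitsList G u v [] = false
hitsList G u v ((e , _) ∷ B) = (match u v e ∨ match v u e) ∨ hitsList G u v B

hitsSym : ∀ {n} (G : Graph n) (u v : Fin n) (B : List (Edge G)) →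
          hitsList G u v B ≡ hitsList G v u B
hitsSym G u v [] = refl
hitsSym G u v ((e , _) ∷ B) = cong₂ _∨_ (∨-comm (match u v e) (match v u e)) (hitsSym G u v B)

_─_ : ∀ {n} (G : Graph n) → List (Edge G) → Graph n
adj   (G ─ B) u v = adj G u v ∧ not (hitsList G u v B)
sym   (G ─ B) u v = cong₂ (λ x y → x ∧ not y) (sym G u v) (hitsSym G u v B)
irefl (G ─ B) v rewrite irefl G v = refl

IsDRDF : ∀ {n} → Graph n → (Fin n → Fin 4) → Set
IsDRDF {n} G f = ∀ v →
  (toℕ (f v) ≡ 0 →
     (∃[ u ] ∃[ w ] (u ≢ w × Adj G v u × Adj G v w × toℕ (f u) ≡ 2 × toℕ (f w) ≡ 2))
     ⊎ (∃[ w ] (Adj G v w × toℕ (f w) ≡ 3)))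
  × (toℕ (f v) ≡ 1 → ∃[ w ] (Adj G v w × 2 ≤ toℕ (f w)))

weight : ∀ {n} → (Fin n → Fin 4) → ℕ
weight {n} f = sum (map (λ v → toℕ (f v)) (allFin n))

IsγdR : ∀ {n} → Graph n → ℕ → Set
IsγdR G k = (∃[ f ] (IsDRDF G f × weight f ≡ k)) × (∀ f → IsDRDF G f → k ≤ weight f)

-- b_dR(G) ≤ m : some set B of at most m edges of G has γ_dR(G − B) > γ_dR(G).
-- (B is given as a list of edges; its cardinality is at most its length.)
BondageAtMost : ∀ {n} → Graph n → ℕ → Set
BondageAtMost G m = ∃[ B ] (length B ≤ m × (∀ k k' → IsγdR G k → IsγdR (G ─ B) k' → k < k'))

module Submission where

-- A longest path in T ends in a leaf a whose neighbour u is either adjacent to a second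
-- leaf b, or has degree two with other neighbour b.  Delete B = {ua, ub}.  In T − B the
-- vertex a and one of u, b are isolated, so every DRDF f′ of T − B gives both weight
-- at least 2.  Setting u to 3 and its leaves among a, b to 0 yields a DRDF of T
-- (those leaves are now dominated by u, and raising a value to 3 never hurts), and this
-- trades at least 4 for 3, so γ_dR(T) < γ_dR(T − B).

open import Defs
open import Data.Nat using (ℕ; _≤_)
open import Data.Nat.Base using (zero; suc; _+_; _<_; z≤n; s≤s)
open import Data.Nat.Properties
  using (≤-refl; ≤-trans; ≤-reflexive; <⇒≤; <⇒≱; ≤-<-trans; n≤1+n; m≤m+n; m≤n+m;
         +-assoc; +-comm; +-suc; +-identityʳ; +-mono-≤; +-monoʳ-≤; +-cancelʳ-≤; module ≤-Reasoning)
open import Data.Fin using (Fin; toℕ; #_) renaming (zero to fzero; suc to fsuc)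
open import Data.Fin.Properties using (_≟_; any?; injective⇒≤)
open import Data.Vec.Functional using (Vector; updateAt)
open import Data.Vec.Functional.Properties using (updateAt-updates; updateAt-minimal; map-updateAt-local)
open import Data.Bool.Base using (true; false; _∧_; _∨_; not)
open import Data.Bool.Properties using (∧-conicalˡ; ∧-zeroʳ; ∨-zeroʳ) renaming (_≟_ to _≟ᴮ_)
open import Data.List.Base using (List; []; _∷_; [_]; _++_; _∷ʳ_; length; lookup; tabulate; last)
open import Data.List.Properties using (++-assoc; map-tabulate; tabulate-cong)
open import Data.List.Relation.Unary.All as All using ([]; _∷_)
open import Data.List.Relation.Unary.All.Properties using (¬Any⇒All¬; ++⁻ˡ)
open import Data.List.Relation.Unary.Any using (here; there; index)
open import Data.List.Relation.Unary.Any.Properties using (lookup-index; singleton⁻)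
open import Data.List.Relation.Unary.AllPairs as AllPairs using ([]; _∷_)
open import Data.List.Relation.Unary.Unique.Propositional using (Unique)
open import Data.List.Membership.Propositional using (_∈_; _∉_)
open import Data.List.Membership.Propositional.Properties using (∈-∃++; ∈-lookup)
import Data.List.Membership.DecPropositional as DecMembership
open import Data.Nat.ListAction using (sum)
open import Data.Maybe.Base using (just)
open import Data.Product.Base using (∃-syntax; _×_; _,_; proj₁)
open import Data.Sum.Base using (_⊎_; inj₁; inj₂; [_,_]′)
open import Function.Base using (id; const; _∘_)
open import Function.Definitions using (Injective)
open import Relation.Nullary using (¬_; Dec; yes; no; contradiction)
open import Relation.Nullary.Decidable using (¬?; _×-dec_; decidable-stable)
open import Relation.Binary.PropositionalEquality as ≡
  using (_≡_; _≢_; refl; cong; trans; subst; module ≡-Reasoning)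

Adj-sym : ∀ {n} (G : Graph n) {x y} → Adj G x y → Adj G y x
Adj-sym G {x} {y} xy = trans (sym G y x) xy

Adj-irrefl : ∀ {n} (G : Graph n) {x y} → Adj G x y → x ≢ y
Adj-irrefl G {x} xy refl with trans (≡.sym xy) (irefl G x)
... | ()

Leaf : ∀ {n} → Graph n → Fin n → Fin n → Set
Leaf G a u = Adj G a u × (∀ y → Adj G a y → y ≡ u)

_∈?_ : ∀ {n} (x : Fin n) (vs : List (Fin n)) → Dec (x ∈ vs)
_∈?_ = DecMembership._∈?_ _≟_

neighbours⊆? : ∀ {n} (G : Graph n) v (vs : List (Fin n)) →
               (∃[ x ] (Adj G v x × x ∉ vs)) ⊎ (∀ x → Adj G v x → x ∈ vs)
neighbours⊆? G v vs with any? (λ x → (adj G v x ≟ᴮ true) ×-dec ¬? (x ∈? vs))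
... | yes outside = inj₁ outside
... | no none     = inj₂ λ x vx → decidable-stable (x ∈? vs) (λ x∉ → none (x , vx , x∉))

Walk-preserves : ∀ {n} {G : Graph n} (P : Fin n → Set) → (∀ {x y} → P x → Adj G x y → P y) →
                 ∀ {x y} → Walk G x y → P x → P y
Walk-preserves P closed here          px = px
Walk-preserves P closed (step xw wy) px = Walk-preserves P closed wy (closed px xw)

_⊆ᴱ_ : ∀ {n} → Graph n → Graph n → Set
G ⊆ᴱ H = ∀ {x y} → Adj G x y → Adj H x y

─-⊆ᴱ : ∀ {n} (G : Graph n) (B : List (Edge G)) → (G ─ B) ⊆ᴱ G
─-⊆ᴱ G B {x} {y} = ∧-conicalˡ (adj G x y) _

match-refl : ∀ {n} (p q : Fin n) → match p q (p , q) ≡ true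
match-refl p q with p ≟ p | q ≟ q
... | yes _   | yes _   = refl
... | no p≢p  | _       = contradiction refl p≢p
... | yes _   | no q≢q  = contradiction refl q≢q

hitsList-∈ : ∀ {n} {G : Graph n} {p q pq} {B : List (Edge G)} →
             ((p , q) , pq) ∈ B → hitsList G p q B ≡ true
hitsList-∈ {G = G} {p} {q} (here {xs = B} refl) =
  cong (λ m → (m ∨ match q p (p , q)) ∨ hitsList G p q B) (match-refl p q)
hitsList-∈ (there e∈B) = trans (cong (_ ∨_) (hitsList-∈ e∈B)) (∨-zeroʳ _)

deleted : ∀ {n} {G : Graph n} {p q pq} {B : List (Edge G)} →
          ((p , q) , pq) ∈ B → ¬ Adj (G ─ B) p q
deleted {G = G} {p} {q} {B = B} e∈B pq′ = contradiction (begin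
  false                  ≡⟨ ≡.sym (∧-zeroʳ (adj G p q)) ⟩
  adj G p q ∧ not true   ≡⟨ cong (λ h → adj G p q ∧ not h) (≡.sym (hitsList-∈ e∈B)) ⟩
  adj (G ─ B) p q        ≡⟨ pq′ ⟩
  true                   ∎) λ ()
  where open ≡-Reasoning

deleted′ : ∀ {n} {G : Graph n} {p q pq} {B : List (Edge G)} →
           ((p , q) , pq) ∈ B → ¬ Adj (G ─ B) q p
deleted′ {G = G} {B = B} e∈B = deleted e∈B ∘ Adj-sym (G ─ B)

leaf-isolated : ∀ {n} {G : Graph n} {a u ua} {B : List (Edge G)} →
                Leaf G a u → ((u , a) , ua) ∈ B → ∀ y → ¬ Adj (G ─ B) a y
leaf-isolated {G = G} {B = B} (_ , only-u) e∈B y ay with only-u y (─-⊆ᴱ G B ay)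
... | refl = deleted′ e∈B ay

lookup-injective : ∀ {A : Set} {xs : List A} → Unique xs → Injective _≡_ _≡_ (lookup xs)
lookup-injective (_ ∷ _) {fzero}  {fzero}  _  = refl
lookup-injective (x∉ ∷ _) {fzero}  {fsuc j} eq = contradiction eq (All.lookup x∉ (∈-lookup j))
lookup-injective (x∉ ∷ _) {fsuc i} {fzero}  eq = contradiction (≡.sym eq) (All.lookup x∉ (∈-lookup i))
lookup-injective (_ ∷ u)  {fsuc i} {fsuc j} eq = cong fsuc (lookup-injective u eq)

unique⇒length≤ : ∀ {n} {xs : List (Fin n)} → Unique xs → length xs ≤ n
unique⇒length≤ u = injective⇒≤ (lookup-injective u)

covering⇒≤length : ∀ {n} {xs : List (Fin n)} → (∀ z → z ∈ xs) → n ≤ length xs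
covering⇒≤length {xs = xs} cover = injective⇒≤ index-injective
  where
  index-injective : Injective _≡_ _≡_ (λ z → index (cover z))
  index-injective {z} {z′} eq =
    trans (lookup-index (cover z)) (trans (cong (lookup xs) eq) (≡.sym (lookup-index (cover z′))))

Unique-++⁻ˡ : ∀ {A : Set} (xs : List A) {ys} → Unique (xs ++ ys) → Unique xs
Unique-++⁻ˡ []       _        = []
Unique-++⁻ˡ (x ∷ xs) (x∉ ∷ u) = ++⁻ˡ xs x∉ ∷ Unique-++⁻ˡ xs u

Chain-++⁻ˡ : ∀ {n} {G : Graph n} xs {ys} → Chain G (xs ++ ys) → Chain G xs
Chain-++⁻ˡ []           _        = []
Chain-++⁻ˡ (x ∷ [])     _        = [-]
Chain-++⁻ˡ (x ∷ y ∷ xs) (xy ∷ c) = xy ∷ Chain-++⁻ˡ (y ∷ xs) c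

last-∷ʳ : ∀ {A : Set} (xs : List A) {x} → last (xs ∷ʳ x) ≡ just x
last-∷ʳ []           = refl
last-∷ʳ (_ ∷ [])     = refl
last-∷ʳ (_ ∷ y ∷ xs) = last-∷ʳ (y ∷ xs)

1≤length-∷ʳ : ∀ {A : Set} (xs : List A) {x} → 1 ≤ length (xs ∷ʳ x)
1≤length-∷ʳ []      = s≤s z≤n
1≤length-∷ʳ (_ ∷ _) = s≤s z≤n

no-chord : ∀ {n} {T : Graph n} → Acyclic T → ∀ {w v rest x} →
           Unique (w ∷ v ∷ rest) → Chain T (w ∷ v ∷ rest) → x ∈ rest → ¬ Adj T x w
no-chord {T = T} acyclic {w} {v} {x = x} u c x∈rest xw with ∈-∃++ x∈rest
... | ys , zs , refl = acyclic cycle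
  ( s≤s (s≤s (1≤length-∷ʳ ys))
  , Unique-++⁻ˡ cycle (subst Unique split u)
  , Chain-++⁻ˡ cycle (subst (Chain T) split c)
  , w , x , refl , last-∷ʳ (w ∷ v ∷ ys) , xw )
  where
  cycle : List (Fin _)
  cycle = w ∷ v ∷ ys ∷ʳ x
  split : w ∷ v ∷ ys ++ x ∷ zs ≡ cycle ++ zs
  split = cong (λ l → w ∷ v ∷ l) (≡.sym (++-assoc ys [ x ] zs))

record SupportVertex {n} (T : Graph n) : Set where
  field
    u a b                  : Fin n
    a≢b                    : a ≢ b
    a-leaf                 : Leaf T a u
    u~b                    : Adj T u b
    b-leaf-or-u-degree-two : Leaf T b u ⊎ (∀ y → Adj T u y → y ≡ a ⊎ y ≡ b)

record Path {n} (T : Graph n) : Set where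
  constructor path
  field
    end next : Fin n
    rest     : List (Fin n)
    unique   : Unique (end ∷ next ∷ rest)
    chain    : Chain T (end ∷ next ∷ rest)

open Path

prepend : ∀ {n} {T : Graph n} (p : Path T) {x} → Adj T x (end p) → x ∉ end p ∷ next p ∷ rest p → Path T
prepend (path v₀ v₁ rest u c) {x} xv₀ x∉ = path x v₀ (v₁ ∷ rest) (¬Any⇒All¬ _ x∉ ∷ u) (xv₀ ∷ c)

initial-path : ∀ {n} {T : Graph n} → Connected T → 2 ≤ n → Path T
initial-path {T = T} connected (s≤s (s≤s _)) with connected fzero (fsuc fzero)
... | step {w = w} 0w _ = path fzero w [] ((Adj-irrefl T 0w ∷ []) ∷ [] ∷ []) (0w ∷ [-])

module _ {n} {T : Graph n} (acyclic : Acyclic T) where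

  saturated-end-is-leaf : ∀ {v₀ v₁ rest} → Unique (v₀ ∷ v₁ ∷ rest) → Chain T (v₀ ∷ v₁ ∷ rest) →
                          (∀ y → Adj T v₀ y → y ∈ v₀ ∷ v₁ ∷ rest) → Leaf T v₀ v₁
  saturated-end-is-leaf {v₀} {v₁} u c@(v₀v₁ ∷ _) saturated = v₀v₁ , only-v₁
    where
    only-v₁ : ∀ y → Adj T v₀ y → y ≡ v₁
    only-v₁ y v₀y with saturated y v₀y
    ... | here refl         = contradiction refl (Adj-irrefl T v₀y)
    ... | there (here y≡v₁) = y≡v₁
    ... | there (there y∈)  = contradiction (Adj-sym T v₀y) (no-chord acyclic u c y∈)

  saturated-next-has-degree-two :
    ∀ {v₀ v₁ v₂ rest} → Unique (v₀ ∷ v₁ ∷ v₂ ∷ rest) → Chain T (v₀ ∷ v₁ ∷ v₂ ∷ rest) →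
    (∀ y → Adj T v₁ y → y ∈ v₀ ∷ v₁ ∷ v₂ ∷ rest) → ∀ y → Adj T v₁ y → y ≡ v₀ ⊎ y ≡ v₂
  saturated-next-has-degree-two (_ ∷ u) (_ ∷ c) saturated y v₁y with saturated y v₁y
  ... | here y≡v₀                 = inj₁ y≡v₀
  ... | there (here refl)         = contradiction refl (Adj-irrefl T v₁y)
  ... | there (there (here y≡v₂)) = inj₂ y≡v₂
  ... | there (there (there y∈))  = contradiction (Adj-sym T v₁y) (no-chord acyclic u c y∈)

closed-edge⇒n≤2 : ∀ {n} {T : Graph n} {v₀ v₁} → Connected T → Leaf T v₀ v₁ →
                  (∀ y → Adj T v₁ y → y ∈ v₀ ∷ v₁ ∷ []) → n ≤ 2
closed-edge⇒n≤2 {T = T} {v₀} {v₁} connected (_ , only-v₁) saturated =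
  covering⇒≤length λ z → Walk-preserves (_∈ v₀ ∷ v₁ ∷ []) stays (connected v₀ z) (here refl)
  where
  stays : ∀ {x y} → x ∈ v₀ ∷ v₁ ∷ [] → Adj T x y → y ∈ v₀ ∷ v₁ ∷ []
  stays (here refl)         xy = there (here (only-v₁ _ xy))
  stays (there (here refl)) xy = saturated _ xy

Longer : ∀ {n} {T : Graph n} → Path T → Path T → Set
Longer q p = length (rest q) ≡ suc (length (rest p))

module _ {n} {T : Graph n} (connected : Connected T) (acyclic : Acyclic T) (n≥3 : 3 ≤ n) where

  grow-from-leaf-end : (p : Path T) → Leaf T (end p) (next p) → (∃[ q ] Longer q p) ⊎ SupportVertex T
  grow-from-leaf-end (path v₀ v₁ rest u c@(_ ∷ v₁⋯)) v₀-leaf with neighbours⊆? T v₁ (v₀ ∷ v₁ ∷ rest)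
  ... | inj₁ (w , v₁w , w∉) with neighbours⊆? T w [ v₁ ]
  ...   | inj₁ (x , wx , x∉[v₁]) = inj₁ (prepend p′ (Adj-sym T wx) x∉ , refl)
    where
    u′ : Unique (w ∷ v₁ ∷ rest)
    u′ = ¬Any⇒All¬ _ (w∉ ∘ there) ∷ AllPairs.tail u
    c′ : Chain T (w ∷ v₁ ∷ rest)
    c′ = Adj-sym T v₁w ∷ v₁⋯
    p′ : Path T
    p′ = path w v₁ rest u′ c′
    x∉ : x ∉ w ∷ v₁ ∷ rest
    x∉ (here refl)         = Adj-irrefl T wx refl
    x∉ (there (here x≡v₁)) = x∉[v₁] (here x≡v₁)
    x∉ (there (there x∈))  = no-chord acyclic u′ c′ x∈ (Adj-sym T wx)
  ...   | inj₂ w-saturated = inj₂ record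
    { u = v₁ ; a = v₀ ; b = w
    ; a≢b = w∉ ∘ here ∘ ≡.sym
    ; a-leaf = v₀-leaf
    ; u~b = v₁w
    ; b-leaf-or-u-degree-two = inj₁ (Adj-sym T v₁w , λ y wy → singleton⁻ (w-saturated y wy))
    }
  grow-from-leaf-end (path v₀ v₁ [] u c) v₀-leaf | inj₂ v₁-saturated =
    contradiction (closed-edge⇒n≤2 connected v₀-leaf v₁-saturated) (<⇒≱ n≥3)
  grow-from-leaf-end (path v₀ v₁ (v₂ ∷ rest) u@((_ ∷ v₀≢v₂ ∷ _) ∷ _) c@(_ ∷ v₁v₂ ∷ _)) v₀-leaf
    | inj₂ v₁-saturated = inj₂ record
    { u = v₁ ; a = v₀ ; b = v₂
    ; a≢b = v₀≢v₂
    ; a-leaf = v₀-leaf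
    ; u~b = v₁v₂
    ; b-leaf-or-u-degree-two = inj₂ (saturated-next-has-degree-two acyclic u c v₁-saturated)
    }

  grow-or-find : (p : Path T) → (∃[ q ] Longer q p) ⊎ SupportVertex T
  grow-or-find p with neighbours⊆? T (end p) (end p ∷ next p ∷ rest p)
  ... | inj₁ (x , v₀x , x∉) = inj₁ (prepend p (Adj-sym T v₀x) x∉ , refl)
  ... | inj₂ saturated     =
    grow-from-leaf-end p (saturated-end-is-leaf acyclic (unique p) (chain p) saturated)

  search : ∀ k (p : Path T) → n ≤ length (rest p) + k → SupportVertex T
  search zero p n≤ =
    contradiction (≤-trans n≤ (≤-reflexive (+-identityʳ _)))
                  (<⇒≱ (≤-trans (n≤1+n _) (unique⇒length≤ (unique p))))
  search (suc k) p n≤ with grow-or-find p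
  ... | inj₂ s            = s
  ... | inj₁ (q , longer) =
    search k q (subst (λ l → n ≤ l + k) (≡.sym longer) (≤-trans n≤ (≤-reflexive (+-suc _ k))))

support-vertex : ∀ {n} {T : Graph n} → IsTree T → 3 ≤ n → SupportVertex T
support-vertex {n} (connected , acyclic) n≥3 =
  search connected acyclic n≥3 n (initial-path connected (<⇒≤ n≥3)) (m≤n+m n _)

Condition₀ : ∀ {n} → Graph n → (Fin n → Fin 4) → Fin n → Set
Condition₀ G f v =
  (∃[ p ] ∃[ q ] (p ≢ q × Adj G v p × Adj G v q × toℕ (f p) ≡ 2 × toℕ (f q) ≡ 2))
  ⊎ (∃[ w ] (Adj G v w × toℕ (f w) ≡ 3))

Condition₁ : ∀ {n} → Graph n → (Fin n → Fin 4) → Fin n → Set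
Condition₁ G f v = ∃[ w ] (Adj G v w × 2 ≤ toℕ (f w))

Dominated : ∀ {n} → Graph n → (Fin n → Fin 4) → Fin n → Set
Dominated G f v = (toℕ (f v) ≡ 0 → Condition₀ G f v) × (toℕ (f v) ≡ 1 → Condition₁ G f v)

dominated-by-3 : ∀ {n} {G : Graph n} {f v} → toℕ (f v) ≡ 3 → Dominated G f v
dominated-by-3 fv≡3 = (λ fv≡0 → contradiction (trans (≡.sym fv≡3) fv≡0) λ ())
                    , (λ fv≡1 → contradiction (trans (≡.sym fv≡3) fv≡1) λ ())

Dominated-transfer : ∀ {n} {G H : Graph n} {f g v} → G ⊆ᴱ H → toℕ (g v) ≡ toℕ (f v) →
                     (∀ w → Adj G v w → toℕ (g w) ≡ 3 ⊎ toℕ (g w) ≡ toℕ (f w)) →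
                     Dominated G f v → Dominated H g v
Dominated-transfer {G = G} {H} {f} {g} {v} G⊆H gv≡fv upgrade (cond₀ , cond₁) =
  (λ gv≡0 → transfer₀ (cond₀ (trans (≡.sym gv≡fv) gv≡0))) ,
  (λ gv≡1 → transfer₁ (cond₁ (trans (≡.sym gv≡fv) gv≡1)))
  where
  transfer₀ : Condition₀ G f v → Condition₀ H g v
  transfer₀ (inj₁ (p , q , p≢q , vp , vq , fp , fq)) with upgrade p vp | upgrade q vq
  ... | inj₁ gp | _       = inj₂ (p , G⊆H vp , gp)
  ... | inj₂ _  | inj₁ gq = inj₂ (q , G⊆H vq , gq)
  ... | inj₂ gp | inj₂ gq = inj₁ (p , q , p≢q , G⊆H vp , G⊆H vq , trans gp fp , trans gq fq)
  transfer₀ (inj₂ (w , vw , fw)) with upgrade w vw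
  ... | inj₁ gw = inj₂ (w , G⊆H vw , gw)
  ... | inj₂ gw = inj₂ (w , G⊆H vw , trans gw fw)
  transfer₁ : Condition₁ G f v → Condition₁ H g v
  transfer₁ (w , vw , fw) with upgrade w vw
  ... | inj₁ gw = w , G⊆H vw , subst (2 ≤_) (≡.sym gw) (s≤s (s≤s z≤n))
  ... | inj₂ gw = w , G⊆H vw , subst (2 ≤_) (≡.sym gw) fw

isolated⇒2≤ : ∀ {n} {G : Graph n} {f} → IsDRDF G f → ∀ {x} → (∀ y → ¬ Adj G x y) → 2 ≤ toℕ (f x)
isolated⇒2≤ {f = f} drdf {x} isolated with f x | drdf x
... | fzero                      | cond₀ , _ with cond₀ refl
...   | inj₁ (p , _ , _ , xp , _) = contradiction xp (isolated p)
...   | inj₂ (w , xw , _)         = contradiction xw (isolated w)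
isolated⇒2≤ drdf isolated | fsuc fzero | _ , cond₁ with cond₁ refl
...   | w , xw , _ = contradiction xw (isolated w)
isolated⇒2≤ drdf isolated | fsuc (fsuc fzero)        | _ = s≤s (s≤s z≤n)
isolated⇒2≤ drdf isolated | fsuc (fsuc (fsuc fzero)) | _ = s≤s (s≤s z≤n)

infixl 5 _[_]≔_

_[_]≔_ : ∀ {A : Set} {n} → Vector A n → Fin n → A → Vector A n
f [ i ]≔ c = updateAt f i (const c)

DRDF-raise : ∀ {n} {G H : Graph n} {f} u → G ⊆ᴱ H → IsDRDF G f → IsDRDF H (f [ u ]≔ # 3)
DRDF-raise {G = G} {H} {f} u G⊆H drdf v with v ≟ u
... | yes refl = dominated-by-3 {G = H} (cong toℕ (updateAt-updates u f))
... | no v≢u   = Dominated-transfer {G = G} {H} {v = v} G⊆H (cong toℕ (updateAt-minimal v u f v≢u)) raised (drdf v)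
  where
  raised : ∀ w → Adj G v w → toℕ ((f [ u ]≔ # 3) w) ≡ 3 ⊎ toℕ ((f [ u ]≔ # 3) w) ≡ toℕ (f w)
  raised w _ with w ≟ u
  ... | yes refl = inj₁ (cong toℕ (updateAt-updates u f))
  ... | no w≢u   = inj₂ (cong toℕ (updateAt-minimal w u f w≢u))

DRDF-zero-leaf : ∀ {n} {G : Graph n} {f a u} → IsDRDF G f → toℕ (f u) ≡ 3 → Leaf G a u →
                 IsDRDF G (f [ a ]≔ # 0)
DRDF-zero-leaf {G = G} {f} {a} {u} drdf fu≡3 (au , only-u) = dominated
  where
  g : Fin _ → Fin 4
  g = f [ a ]≔ # 0
  gu≡3 : toℕ (g u) ≡ 3
  gu≡3 = trans (cong toℕ (updateAt-minimal u a f (Adj-irrefl G au ∘ ≡.sym))) fu≡3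
  dominated : IsDRDF G g
  dominated v with v ≟ a | v ≟ u
  ... | yes refl | _        =
    (λ _ → inj₂ (u , au , gu≡3)) ,
    (λ ga≡1 → contradiction (trans (≡.sym (cong toℕ (updateAt-updates a f))) ga≡1) λ ())
  ... | no _     | yes refl = dominated-by-3 {G = G} gu≡3
  ... | no v≢a   | no v≢u   =
    Dominated-transfer {G = G} {G} {v = v} id (cong toℕ (updateAt-minimal v a f v≢a)) unchanged (drdf v)
    where
    unchanged : ∀ w → Adj G v w → toℕ (g w) ≡ 3 ⊎ toℕ (g w) ≡ toℕ (f w)
    unchanged w vw = inj₂ (cong toℕ (updateAt-minimal w a f λ { refl → v≢u (only-u v (Adj-sym G vw)) }))

sum-tabulate-[]≔ : ∀ {n} (xs : Vector ℕ n) i c → sum (tabulate (xs [ i ]≔ c)) + xs i ≡ sum (tabulate xs) + c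
sum-tabulate-[]≔ xs fzero c = begin
  c + S + x₀    ≡⟨ +-comm (c + S) x₀ ⟩
  x₀ + (c + S)  ≡⟨ cong (x₀ +_) (+-comm c S) ⟩
  x₀ + (S + c)  ≡⟨ +-assoc x₀ S c ⟨
  x₀ + S + c    ∎
  where
  open ≡-Reasoning
  x₀ S : ℕ
  x₀ = xs fzero
  S  = sum (tabulate (xs ∘ fsuc))
sum-tabulate-[]≔ xs (fsuc i) c = begin
  x₀ + S′ + xs (fsuc i)    ≡⟨ +-assoc x₀ S′ (xs (fsuc i)) ⟩
  x₀ + (S′ + xs (fsuc i))  ≡⟨ cong (x₀ +_) (sum-tabulate-[]≔ (xs ∘ fsuc) i c) ⟩
  x₀ + (S + c)             ≡⟨ +-assoc x₀ S c ⟨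
  x₀ + S + c               ∎
  where
  open ≡-Reasoning
  x₀ S S′ : ℕ
  x₀ = xs fzero
  S  = sum (tabulate (xs ∘ fsuc))
  S′ = sum (tabulate ((xs ∘ fsuc) [ i ]≔ c))

weight≡sum-tabulate : ∀ {n} (f : Fin n → Fin 4) → weight f ≡ sum (tabulate (toℕ ∘ f))
weight≡sum-tabulate f = cong sum (map-tabulate id (toℕ ∘ f))

weight-[]≔ : ∀ {n} (f : Fin n → Fin 4) i c → weight (f [ i ]≔ c) + toℕ (f i) ≡ weight f + toℕ c
weight-[]≔ f i c = begin
  weight (f [ i ]≔ c) + toℕ (f i)
    ≡⟨ cong (_+ toℕ (f i)) (weight≡sum-tabulate (f [ i ]≔ c)) ⟩
  sum (tabulate (toℕ ∘ (f [ i ]≔ c))) + toℕ (f i)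
    ≡⟨ cong (λ xs → sum xs + toℕ (f i)) (tabulate-cong toℕ-[]≔) ⟩
  sum (tabulate ((toℕ ∘ f) [ i ]≔ toℕ c)) + toℕ (f i)
    ≡⟨ sum-tabulate-[]≔ (toℕ ∘ f) i (toℕ c) ⟩
  sum (tabulate (toℕ ∘ f)) + toℕ c
    ≡⟨ cong (_+ toℕ c) (weight≡sum-tabulate f) ⟨
  weight f + toℕ c
    ∎
  where
  open ≡-Reasoning
  toℕ-[]≔ : ∀ j → toℕ ((f [ i ]≔ c) j) ≡ ((toℕ ∘ f) [ i ]≔ toℕ c) j
  toℕ-[]≔ = map-updateAt-local {f = toℕ} f i refl

weight-reassign : ∀ {n} (f : Fin n → Fin 4) {a u} → a ≢ u →
                  weight ((f [ u ]≔ # 3) [ a ]≔ # 0) + toℕ (f a) + toℕ (f u) ≡ weight f + 3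
weight-reassign f {a} {u} a≢u = begin
  weight (f′ [ a ]≔ # 0) + toℕ (f a) + toℕ (f u)
    ≡⟨ cong (λ t → weight (f′ [ a ]≔ # 0) + toℕ t + toℕ (f u)) (updateAt-minimal a u f a≢u) ⟨
  weight (f′ [ a ]≔ # 0) + toℕ (f′ a) + toℕ (f u)
    ≡⟨ cong (_+ toℕ (f u)) (trans (weight-[]≔ f′ a (# 0)) (+-identityʳ _)) ⟩
  weight f′ + toℕ (f u)
    ≡⟨ weight-[]≔ f u (# 3) ⟩
  weight f + 3
    ∎
  where
  open ≡-Reasoning
  f′ : Fin _ → Fin 4
  f′ = f [ u ]≔ # 3

m+x+y≤n+3⇒m<n : ∀ {m n x y} → m + x + y ≤ n + 3 → 2 ≤ x → 2 ≤ y → m < n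
m+x+y≤n+3⇒m<n {m} {n} {x} {y} le x≥2 y≥2 = +-cancelʳ-≤ 3 (suc m) n (begin
  suc m + 3   ≡⟨ +-suc m 3 ⟨
  m + 4       ≡⟨ +-assoc m 2 2 ⟨
  m + 2 + 2   ≤⟨ +-mono-≤ (+-monoʳ-≤ m x≥2) y≥2 ⟩
  m + x + y   ≤⟨ le ⟩
  n + 3       ∎)
  where open ≤-Reasoning

γdR-increases : ∀ {n} {G : Graph n} {B : List (Edge G)} →
                (∀ f′ → IsDRDF (G ─ B) f′ → ∃[ f ] (IsDRDF G f × weight f < weight f′)) →
                ∀ k k′ → IsγdR G k → IsγdR (G ─ B) k′ → k < k′
γdR-increases lighter k _ (_ , k-minimal) ((f′ , drdf′ , refl) , _) with lighter f′ drdf′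
... | f , drdf , f<f′ = ≤-<-trans (k-minimal f drdf) f<f′

bondage-edges : ∀ {n} {T : Graph n} → SupportVertex T → List (Edge T)
bondage-edges {T = T} s = ((u , a) , Adj-sym T (proj₁ a-leaf)) ∷ ((u , b) , u~b) ∷ []
  where open SupportVertex s

module _ {n} {T : Graph n} (s : SupportVertex T) where
  open SupportVertex s

  private
    B : List (Edge T)
    B = bondage-edges s

    a≢u : a ≢ u
    a≢u = Adj-irrefl T (proj₁ a-leaf)

    b≢u : b ≢ u
    b≢u = Adj-irrefl T u~b ∘ ≡.sym

    a-isolated : ∀ y → ¬ Adj (T ─ B) a y
    a-isolated = leaf-isolated {G = T} {B = B} a-leaf (here refl)

  lighter-DRDF : ∀ f′ → IsDRDF (T ─ B) f′ → ∃[ f ] (IsDRDF T f × weight f < weight f′)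
  lighter-DRDF f′ drdf′ = [ two-leaves , degree-two ]′ b-leaf-or-u-degree-two
    where
    g : Fin n → Fin 4
    g = (f′ [ u ]≔ # 3) [ a ]≔ # 0

    g-drdf : IsDRDF T g
    g-drdf = DRDF-zero-leaf {G = T} (DRDF-raise {G = T ─ B} {T} {f′} u (─-⊆ᴱ T B) drdf′)
                            (cong toℕ (updateAt-updates u f′)) a-leaf

    isolated⇒2≤′ : ∀ {x} → (∀ y → ¬ Adj (T ─ B) x y) → 2 ≤ toℕ (f′ x)
    isolated⇒2≤′ = isolated⇒2≤ {G = T ─ B} drdf′

    degree-two : (∀ y → Adj T u y → y ≡ a ⊎ y ≡ b) → ∃[ f ] (IsDRDF T f × weight f < weight f′)
    degree-two u-degree-two =
      g , g-drdf ,
      m+x+y≤n+3⇒m<n (≤-reflexive (weight-reassign f′ a≢u))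
                    (isolated⇒2≤′ a-isolated) (isolated⇒2≤′ u-isolated)
      where
      u-isolated : ∀ y → ¬ Adj (T ─ B) u y
      u-isolated y uy with u-degree-two y (─-⊆ᴱ T B uy)
      ... | inj₁ refl = deleted {G = T} {B = B} (here refl) uy
      ... | inj₂ refl = deleted {G = T} {B = B} (there (here refl)) uy

    two-leaves : Leaf T b u → ∃[ f ] (IsDRDF T f × weight f < weight f′)
    two-leaves b-leaf =
      h , DRDF-zero-leaf {G = T} g-drdf gu≡3 b-leaf ,
      m+x+y≤n+3⇒m<n weight-bound (isolated⇒2≤′ b-isolated) (isolated⇒2≤′ a-isolated)
      where
      h : Fin n → Fin 4
      h = g [ b ]≔ # 0

      b-isolated : ∀ y → ¬ Adj (T ─ B) b y
      b-isolated = leaf-isolated {G = T} {B = B} b-leaf (there (here refl))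

      gu≡3 : toℕ (g u) ≡ 3
      gu≡3 = cong toℕ (trans (updateAt-minimal u a _ (a≢u ∘ ≡.sym)) (updateAt-updates u f′))

      h-weight : weight h + toℕ (f′ b) ≡ weight g
      h-weight = begin
        weight h + toℕ (f′ b)               ≡⟨ cong (λ t → weight h + toℕ t) (updateAt-minimal b u f′ b≢u) ⟨
        weight h + toℕ ((f′ [ u ]≔ # 3) b)  ≡⟨ cong (λ t → weight h + toℕ t) (updateAt-minimal b a _ (a≢b ∘ ≡.sym)) ⟨
        weight h + toℕ (g b)                ≡⟨ weight-[]≔ g b (# 0) ⟩
        weight g + 0                        ≡⟨ +-identityʳ _ ⟩
        weight g                            ∎
        where open ≡-Reasoning

      -- Here u need not be isolated in T − B, so f′ u only enters as a nonnegative slack.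
      weight-bound : weight h + toℕ (f′ b) + toℕ (f′ a) ≤ weight f′ + 3
      weight-bound = begin
        weight h + toℕ (f′ b) + toℕ (f′ a)               ≤⟨ m≤m+n _ (toℕ (f′ u)) ⟩
        weight h + toℕ (f′ b) + toℕ (f′ a) + toℕ (f′ u)  ≡⟨ cong (λ t → t + toℕ (f′ a) + toℕ (f′ u)) h-weight ⟩
        weight g + toℕ (f′ a) + toℕ (f′ u)               ≡⟨ weight-reassign f′ a≢u ⟩
        weight f′ + 3                                    ∎
        where open ≤-Reasoning

corollary3p4 : ∀ {n : ℕ} (T : Graph n) → IsTree T → 3 ≤ n → BondageAtMost T 2
corollary3p4 T tree n≥3 =
  bondage-edges s , ≤-refl , γdR-increases {G = T} {B = bondage-edges s} (lighter-DRDF s)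
  where
  s : SupportVertex T
  s = support-vertex tree n≥3
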